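{- Let $c,m>0$ and $k\geq2$. Every $(k+1)$-partite $(k+1)$-graph $H$ on $V_0\cup V_1\cup\cdots\cup V_k$ with at most $m$ vertices in each part and with at least $cm^{k+1}$ edges contains a $(0,k-1)$-path with at least $cm/k$ vertices.
   Context: A $(k+1)$-partite $(k+1)$-graph on $V_0\cup\cdots\cup V_k$ is a hypergraph each of whose edges has exactly one vertex in each $V_i$. A $(0,k-1)$-path of length $t$ in $H$ is a subhypergraph with distinct vertices $c_1,\ldots,c_t\in V_0$ and distinct vertices $v_1,\ldots,v_{t+k-1}\in V_1\cup\cdots\cup V_k$, and edges $e_i=\{c_i,v_i,v_{i+1},\ldots,v_{i+k-1}\}\in E(H)$ for $i\in[t]$; its vertex set is $\{c_1,\ldots,c_t,v_1,\ldots,v_{t+k-1}\}$.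
   Formalization: The constants c and m range over the positive rationals. -}

module Defs where

open import Data.Nat as ℕ using (ℕ; zero; suc; _+_; _∸_; _<_)
open import Data.Fin using (Fin)
open import Data.Fin.Properties using (_≟_)
open import Data.Vec using (Vec; lookup)
open import Data.Vec.Membership.Propositional renaming (_∈_ to _∈ᵥ_)
open import Data.List using (List; length; filter)
open import Data.List.Base using (allFin)
open import Data.List.Membership.Propositional using (_∈_)
open import Data.List.Relation.Unary.Unique.Propositional using (Unique)
open import Data.Product using (Σ; ∃; _×_; _,_)
open import Data.Sum using (_⊎_)
open import Relation.Binary.PropositionalEquality using (_≡_; _≢_)
open import Function.Bundles using (_⇔_)
open import Data.Rational using (ℚ; 1ℚ; _*_)

_^ℚ_ : ℚ → ℕ → ℚ
q ^ℚ zero  = 1ℚ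
q ^ℚ suc n = q * (q ^ℚ n)

-- Vertices are Fin N; `part v` is the index i of the part V_i containing v.
-- An edge is stored as a vector whose i-th entry is its vertex in V_i;
-- the edge list has no repetitions.
record PartiteHypergraph (k : ℕ) : Set where
  field
    N      : ℕ
    part   : Fin N → Fin (suc k)
    edges  : List (Vec (Fin N) (suc k))
    edges-partite : ∀ e → e ∈ edges → ∀ i → part (lookup e i) ≡ i
    edges-unique  : Unique edges

  partSize : Fin (suc k) → ℕ
  partSize i = length (filter (λ v → part v ≟ i) (allFin N))

  numEdges : ℕ
  numEdges = length edges

  IsEdge : (Fin N → Set) → Set
  IsEdge S = Σ (Vec (Fin N) (suc k)) λ e → e ∈ edges × (∀ x → (x ∈ᵥ e) ⇔ S x)

  -- A (0,k-1)-path of length t (indices are 0-based here):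
  -- distinct c_0..c_{t-1} ∈ V_0, distinct v_0..v_{t+k-2} ∈ V_1 ∪ ... ∪ V_k,
  -- and for each j < t, {c_j, v_j, ..., v_{j+k-1}} ∈ E(H).
  record Path0 (t : ℕ) : Set where
    field
      c : ℕ → Fin N
      v : ℕ → Fin N
      c-inj  : ∀ a b → a < t → b < t → c a ≡ c b → a ≡ b
      v-inj  : ∀ a b → a < t + k ∸ 1 → b < t + k ∸ 1 → v a ≡ v b → a ≡ b
      c-part : ∀ a → a < t → part (c a) ≡ Fin.zero
      v-part : ∀ a → a < t + k ∸ 1 → part (v a) ≢ Fin.zero
      edge   : ∀ j → j < t →
               IsEdge (λ x → x ≡ c j ⊎ Σ ℕ λ l → l < k × x ≡ v (j + l))

  -- number of vertices of a (0,k-1)-path of length t: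
  -- t vertices in V_0 plus t+k-1 vertices in the other parts.
  pathVertexCount : ℕ → ℕ
  pathVertexCount t = t + (t + k ∸ 1)

open import Data.Integer using (+_)
import Data.Rational as ℚ
ℕtoℚ : ℕ → ℚ
ℕtoℚ n = (+ n) ℚ./ 1

-- Call the k-1 vertices of an edge outside V_0 and V_i its i-th key; there are at most k m^(k-1)
-- possible keys. Deleting, as long as possible, all edges through a key that lies in at most D of the
-- remaining edges removes at most D·#keys edges, so when |E| > D·#keys a nonempty core survives in
-- which every key of every edge lies in more than D edges. In the core a (0,k-1)-path is grown
-- greedily: its next edge must share the key of the last edge that omits the oldest vertex v_t of that
-- edge, and of the more than D edges through this key at most (t+1)|V_i| + |V_0|(t+k) ≤ m·#vertices
-- reuse a vertex of the path. Hence the path keeps growing until D < m·#vertices, and choosing D with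
-- D·#keys < |E| ≤ (D+1)·#keys gives c m^(k+1) ≤ |E| ≤ (D+1) k m^(k-1) ≤ k m^k ·#vertices.

module Submission where

open import Defs

open import Data.Empty using (⊥-elim)
open import Data.Fin as Fin using (Fin)
import Data.Fin.Properties as Fin
open import Data.Integer as ℤ using (+_; +≤+)
import Data.Integer.Properties as ℤ
open import Data.List
  using (List; []; _∷_; [_]; _++_; length; filter; map; concatMap; cartesianProductWith; cartesianProduct; allFin; upTo)
open import Data.List.Properties using (length-++; length-map; length-tabulate; length-upTo; filter-notAll)
open import Data.List.Membership.Propositional using (_∈_; _∉_; lose; find)
open import Data.List.Membership.Propositional.Properties
  using (∈-length; ∈-filter⁺; ∈-filter⁻; ∈-map⁺; ∈-upTo⁺; ∈-upTo⁻; ∈-++⁺ˡ; ∈-++⁺ʳ; ∈-concat⁺′;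
         ∈-cartesianProductWith⁺; ∈-cartesianProduct⁺; ∈-allFin)
import Data.List.Membership.DecPropositional as DecMembership
open import Data.List.Relation.Unary.Any using (Any; here; there; any?)
import Data.List.Relation.Unary.All as All
open import Data.List.Relation.Unary.AllPairs using (_∷_)
open import Data.List.Relation.Unary.Unique.Propositional using (Unique)
open import Data.List.Relation.Unary.Unique.Propositional.Properties using (filter⁺; upTo⁺)
open import Data.Nat as ℕ using (ℕ; zero; suc; _≤_; _<_; z≤n; s≤s)
import Data.Nat.Properties as ℕ
open import Data.Nat.Coprimality using (gcd≡1⇒coprime)
open import Data.Nat.DivMod using (_mod_; m<n⇒m%n≡m)
open import Data.Nat.GCD using (gcd-zeroʳ)
open import Data.Nat.Induction using (<-wellFounded)
open import Data.Product using (Σ; _×_; _,_; proj₁; proj₂)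
open import Data.Product.Properties using (,-injective) renaming (≡-dec to ×-≡-dec)
open import Data.Rational as ℚ using (ℚ; 0ℚ; 1ℚ; _*_; toℚᵘ; nonNegative; positive)
  renaming (_≤_ to _≤ℚ_; _<_ to _<ℚ_)
import Data.Rational.Properties as ℚ
open import Data.Rational.Solver using (module +-*-Solver)
import Data.Rational.Unnormalised as ℚᵘ
import Data.Rational.Unnormalised.Properties as ℚᵘ
open import Data.Sum as Sum using (_⊎_; inj₁; inj₂)
open import Data.Vec using (Vec; lookup; tail; removeAt) renaming (_∷_ to _∷ᵥ_; [] to []ᵥ)
import Data.Vec.Properties as Vecₚ
open Vecₚ using (removeAt-punchOut)
open import Data.Vec.Membership.Propositional using () renaming (_∈_ to _∈ᵥ_)
open import Data.Vec.Membership.Propositional.Properties using (∈-lookup)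
open import Data.Vec.Relation.Binary.Pointwise.Extensional using (ext; Pointwise-≡⇒≡)
import Data.Vec.Relation.Unary.Any as Anyᵥ
open import Data.Vec.Relation.Unary.Any.Properties using (lookup-index)
open import Function using (_∘_; id; case_of_)
open import Function.Bundles using (_⇔_; mk⇔; Equivalence)
open import Function.Construct.Composition using (_⇔-∘_)
open import Induction.WellFounded using (Acc; acc)
open import Relation.Binary.Definitions using (DecidableEquality)
open import Relation.Binary.PropositionalEquality hiding ([_])
open import Relation.Nullary using (¬_; Dec; ¬?; _×-dec_; yes; no)
open import Relation.Unary using (Decidable)
open import Relation.Unary.Properties using (∁?)

toℚᵘ-ℕtoℚ : ∀ n → toℚᵘ (ℕtoℚ n) ≡ ℚᵘ.mkℚᵘ (+ n) 0
toℚᵘ-ℕtoℚ n = cong toℚᵘ (ℚ.normalize-coprime (gcd≡1⇒coprime (gcd-zeroʳ n)))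

ℕtoℚ-homo-+ : ∀ a b → ℕtoℚ (a ℕ.+ b) ≡ ℕtoℚ a ℚ.+ ℕtoℚ b
ℕtoℚ-homo-+ a b = ℚ.toℚᵘ-injective (begin
  toℚᵘ (ℕtoℚ (a ℕ.+ b))                        ≡⟨ toℚᵘ-ℕtoℚ (a ℕ.+ b) ⟩
  ℚᵘ.mkℚᵘ (+ (a ℕ.+ b)) 0                       ≈⟨ ℚᵘ.*≡* eq ⟩
  ℚᵘ.mkℚᵘ (+ a) 0 ℚᵘ.+ ℚᵘ.mkℚᵘ (+ b) 0          ≡⟨ sym (cong₂ ℚᵘ._+_ (toℚᵘ-ℕtoℚ a) (toℚᵘ-ℕtoℚ b)) ⟩
  toℚᵘ (ℕtoℚ a) ℚᵘ.+ toℚᵘ (ℕtoℚ b)              ≈⟨ ℚᵘ.≃-sym (ℚ.toℚᵘ-homo-+ (ℕtoℚ a) (ℕtoℚ b)) ⟩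
  toℚᵘ (ℕtoℚ a ℚ.+ ℕtoℚ b)                      ∎)
  where
  open ℚᵘ.≃-Reasoning
  eq : + (a ℕ.+ b) ℤ.* + 1 ≡ (+ a ℤ.* + 1 ℤ.+ + b ℤ.* + 1) ℤ.* + 1
  eq rewrite ℤ.*-identityʳ (+ a) | ℤ.*-identityʳ (+ b) = cong (ℤ._* + 1) (ℤ.pos-+ a b)

ℕtoℚ-homo-* : ∀ a b → ℕtoℚ (a ℕ.* b) ≡ ℕtoℚ a ℚ.* ℕtoℚ b
ℕtoℚ-homo-* a b = ℚ.toℚᵘ-injective (begin
  toℚᵘ (ℕtoℚ (a ℕ.* b))                        ≡⟨ toℚᵘ-ℕtoℚ (a ℕ.* b) ⟩
  ℚᵘ.mkℚᵘ (+ (a ℕ.* b)) 0                       ≈⟨ ℚᵘ.*≡* (cong (ℤ._* + 1) (ℤ.pos-* a b)) ⟩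
  ℚᵘ.mkℚᵘ (+ a) 0 ℚᵘ.* ℚᵘ.mkℚᵘ (+ b) 0          ≡⟨ sym (cong₂ ℚᵘ._*_ (toℚᵘ-ℕtoℚ a) (toℚᵘ-ℕtoℚ b)) ⟩
  toℚᵘ (ℕtoℚ a) ℚᵘ.* toℚᵘ (ℕtoℚ b)              ≈⟨ ℚᵘ.≃-sym (ℚ.toℚᵘ-homo-* (ℕtoℚ a) (ℕtoℚ b)) ⟩
  toℚᵘ (ℕtoℚ a ℚ.* ℕtoℚ b)                      ∎)
  where open ℚᵘ.≃-Reasoning

ℕtoℚ-mono-≤ : ∀ {a b} → a ≤ b → ℕtoℚ a ≤ℚ ℕtoℚ b
ℕtoℚ-mono-≤ {a} {b} a≤b = ℚ.toℚᵘ-cancel-≤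
  (subst₂ ℚᵘ._≤_ (sym (toℚᵘ-ℕtoℚ a)) (sym (toℚᵘ-ℕtoℚ b))
    (ℚᵘ.*≤* (ℤ.*-monoʳ-≤-nonNeg (+ 1) (+≤+ a≤b))))

ℕtoℚ-nonNeg : ∀ n → 0ℚ ≤ℚ ℕtoℚ n
ℕtoℚ-nonNeg n = ℕtoℚ-mono-≤ {0} {n} z≤n

ℕtoℚ-pos⇒pos : ∀ {n} → 0ℚ <ℚ ℕtoℚ n → 0 < n
ℕtoℚ-pos⇒pos {zero}  0<0 = ⊥-elim (ℚ.<-irrefl refl 0<0)
ℕtoℚ-pos⇒pos {suc n} _   = s≤s z≤n

^ℚ-pos : ∀ {m} → 0ℚ <ℚ m → ∀ n → 0ℚ <ℚ m ^ℚ n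
^ℚ-pos m>0 zero    = ℚ.positive⁻¹ 1ℚ
^ℚ-pos {m} m>0 (suc n) = ℚ.positive⁻¹ (m ℚ.* m ^ℚ n)
  {{ℚ.pos*pos⇒pos m {{positive m>0}} (m ^ℚ n) {{positive (^ℚ-pos m>0 n)}}}}

*-mono-≤-nonNeg : ∀ {p q r s} → 0ℚ ≤ℚ q → 0ℚ ≤ℚ r → p ≤ℚ q → r ≤ℚ s → p ℚ.* r ≤ℚ q ℚ.* s
*-mono-≤-nonNeg {p} {q} {r} {s} q≥0 r≥0 p≤q r≤s = ℚ.≤-trans
  (ℚ.*-monoʳ-≤-nonNeg r {{nonNegative r≥0}} p≤q)
  (ℚ.*-monoˡ-≤-nonNeg q {{nonNegative q≥0}} r≤s)

ℕtoℚ[a*x+y*b]≤m*[a+b] : ∀ {m} a b x y → ℕtoℚ x ≤ℚ m → ℕtoℚ y ≤ℚ m →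
  ℕtoℚ (a ℕ.* x ℕ.+ y ℕ.* b) ≤ℚ m ℚ.* ℕtoℚ (a ℕ.+ b)
ℕtoℚ[a*x+y*b]≤m*[a+b] {m} a b x y x≤m y≤m = begin
  ℕtoℚ (a ℕ.* x ℕ.+ y ℕ.* b)          ≡⟨ trans (ℕtoℚ-homo-+ (a ℕ.* x) (y ℕ.* b))
                                              (cong₂ ℚ._+_ (ℕtoℚ-homo-* a x) (ℕtoℚ-homo-* y b)) ⟩
  ℕtoℚ a ℚ.* ℕtoℚ x ℚ.+ ℕtoℚ y ℚ.* ℕtoℚ b
    ≤⟨ ℚ.+-mono-≤ (ℚ.*-monoˡ-≤-nonNeg (ℕtoℚ a) {{nonNegative (ℕtoℚ-nonNeg a)}} x≤m)
                  (ℚ.*-monoʳ-≤-nonNeg (ℕtoℚ b) {{nonNegative (ℕtoℚ-nonNeg b)}} y≤m) ⟩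
  ℕtoℚ a ℚ.* m ℚ.+ m ℚ.* ℕtoℚ b        ≡⟨ solve 3 (λ a m b → a :* m :+ m :* b := m :* (a :+ b)) refl (ℕtoℚ a) m (ℕtoℚ b) ⟩
  m ℚ.* (ℕtoℚ a ℚ.+ ℕtoℚ b)           ≡⟨ cong (m ℚ.*_) (sym (ℕtoℚ-homo-+ a b)) ⟩
  m ℚ.* ℕtoℚ (a ℕ.+ b)                ∎
  where
  open ℚ.≤-Reasoning
  open +-*-Solver

cancel-powers : ∀ {c m a b w K} (k1 : ℕ) → 0ℚ <ℚ m →
  c ℚ.* m ^ℚ suc (suc k1) ≤ℚ a ℚ.* b → a ≤ℚ m ℚ.* w → b ≤ℚ K ℚ.* m ^ℚ k1 →
  0ℚ ≤ℚ m ℚ.* w → 0ℚ ≤ℚ b → c ℚ.* m ≤ℚ K ℚ.* w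
cancel-powers {c} {m} {a} {b} {w} {K} k1 m>0 cm^k+1≤ab a≤mw b≤Km^k-1 mw≥0 b≥0 =
  ℚ.*-cancelʳ-≤-pos (m ^ℚ suc k1) {{positive (^ℚ-pos m>0 (suc k1))}} (begin
    c ℚ.* m ℚ.* (m ℚ.* M)          ≡⟨ solve 3 (λ c m M → c :* m :* (m :* M) := c :* (m :* (m :* M))) refl c m M ⟩
    c ℚ.* m ^ℚ suc (suc k1)        ≤⟨ cm^k+1≤ab ⟩
    a ℚ.* b                        ≤⟨ *-mono-≤-nonNeg mw≥0 b≥0 a≤mw b≤Km^k-1 ⟩
    m ℚ.* w ℚ.* (K ℚ.* M)          ≡⟨ solve 4 (λ m w K M → m :* w :* (K :* M) := K :* w :* (m :* M)) refl m w K M ⟩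
    K ℚ.* w ℚ.* (m ℚ.* M)          ∎)
  where
  open ℚ.≤-Reasoning
  open +-*-Solver
  M = m ^ℚ k1

*-nonNeg : ∀ {p q} → 0ℚ ≤ℚ p → 0ℚ ≤ℚ q → 0ℚ ≤ℚ p ℚ.* q
*-nonNeg {p} {q} p≥0 q≥0 = ℚ.nonNegative⁻¹ (p ℚ.* q)
  {{ℚ.nonNeg*nonNeg⇒nonNeg p {{nonNegative p≥0}} q {{nonNegative q≥0}}}}

counting-estimate : ∀ {c m} k1 {E D A a b x y} → 0ℚ <ℚ m →
  c ℚ.* m ^ℚ suc (suc k1) ≤ℚ ℕtoℚ E → E ≤ suc D ℕ.* A → ℕtoℚ A ≤ℚ ℕtoℚ (suc k1) ℚ.* m ^ℚ k1 →
  suc D ≤ a ℕ.* x ℕ.+ y ℕ.* b → ℕtoℚ x ≤ℚ m → ℕtoℚ y ≤ℚ m →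
  c ℚ.* m ≤ℚ ℕtoℚ (suc k1) ℚ.* ℕtoℚ (a ℕ.+ b)
counting-estimate {c} {m} k1 {E} {D} {A} {a} {b} {x} {y} m>0 many E≤[1+D]A A≤km^k-1 1+D≤ x≤m y≤m =
  cancel-powers {c} {m} {ℕtoℚ (suc D)} {ℕtoℚ A} {ℕtoℚ (a ℕ.+ b)} {ℕtoℚ (suc k1)} k1 m>0
    (ℚ.≤-trans many (ℚ.≤-trans (ℕtoℚ-mono-≤ E≤[1+D]A) (ℚ.≤-reflexive (ℕtoℚ-homo-* (suc D) A))))
    (ℚ.≤-trans (ℕtoℚ-mono-≤ 1+D≤) (ℕtoℚ[a*x+y*b]≤m*[a+b] a b x y x≤m y≤m))
    A≤km^k-1
    (*-nonNeg (ℚ.<⇒≤ m>0) (ℕtoℚ-nonNeg (a ℕ.+ b)))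
    (ℕtoℚ-nonNeg A)

length-filter-+-∁ : ∀ {A : Set} {P : A → Set} (P? : Decidable P) xs →
  length (filter P? xs) ℕ.+ length (filter (∁? P?) xs) ≡ length xs
length-filter-+-∁ P? [] = refl
length-filter-+-∁ P? (x ∷ xs) with P? x
... | yes _ = cong suc (length-filter-+-∁ P? xs)
... | no _  = trans (ℕ.+-suc _ _) (cong suc (length-filter-+-∁ P? xs))

length-≤-injection : ∀ {A B : Set} → DecidableEquality B → (f : A → B) {xs : List A} {ys : List B} →
  Unique xs → (∀ {x y} → x ∈ xs → y ∈ xs → f x ≡ f y → x ≡ y) → (∀ {x} → x ∈ xs → f x ∈ ys) →
  length xs ≤ length ys
length-≤-injection _≟_ f {[]}     _              _   _    = z≤n
length-≤-injection _≟_ f {x ∷ xs} {ys} (x∉xs ∷ xs!) inj into = begin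
  suc (length xs)                  ≤⟨ s≤s (length-≤-injection _≟_ f xs! (λ p q → inj (there p) (there q)) into′) ⟩
  suc (length (filter ≢fx? ys))    ≤⟨ filter-notAll ≢fx? ys (lose (into (here refl)) (λ ≢ → ≢ refl)) ⟩
  length ys                        ∎
  where
  open ℕ.≤-Reasoning
  ≢fx? : Decidable (_≢ f x)
  ≢fx? y = ¬? (y ≟ f x)
  into′ : ∀ {z} → z ∈ xs → f z ∈ filter ≢fx? ys
  into′ z∈xs = ∈-filter⁺ ≢fx? (into (there z∈xs))
    (λ fz≡fx → All.lookup x∉xs z∈xs (inj (here refl) (there z∈xs) (sym fz≡fx)))

length-cartesianProductWith : ∀ {A B C : Set} (f : A → B → C) xs ys →
  length (cartesianProductWith f xs ys) ≡ length xs ℕ.* length ys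
length-cartesianProductWith f []       ys = refl
length-cartesianProductWith f (x ∷ xs) ys = trans (length-++ (map (f x) ys))
  (cong₂ ℕ._+_ (length-map (f x) ys) (length-cartesianProductWith f xs ys))

vectorsFrom : ∀ {X : Set} n → (Fin n → List X) → List (Vec X n)
vectorsFrom zero    A = [ []ᵥ ]
vectorsFrom (suc n) A = cartesianProductWith _∷ᵥ_ (A Fin.zero) (vectorsFrom n (A ∘ Fin.suc))

∈-vectorsFrom : ∀ {X : Set} {n} (A : Fin n → List X) (v : Vec X n) →
  (∀ p → lookup v p ∈ A p) → v ∈ vectorsFrom n A
∈-vectorsFrom A []ᵥ       _   = here refl
∈-vectorsFrom A (x ∷ᵥ v) v∈A = ∈-cartesianProductWith⁺ _∷ᵥ_ (v∈A Fin.zero)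
  (∈-vectorsFrom (A ∘ Fin.suc) v (v∈A ∘ Fin.suc))

length-vectorsFrom-≤ : ∀ {X : Set} {m} → 0ℚ ≤ℚ m → ∀ n (A : Fin n → List X) →
  (∀ p → ℕtoℚ (length (A p)) ≤ℚ m) → ℕtoℚ (length (vectorsFrom n A)) ≤ℚ m ^ℚ n
length-vectorsFrom-≤ m≥0 zero    A _   = ℚ.≤-refl
length-vectorsFrom-≤ {m = m} m≥0 (suc n) A A≤m = begin
  ℕtoℚ (length (vectorsFrom (suc n) A))               ≡⟨ cong ℕtoℚ (length-cartesianProductWith _∷ᵥ_ (A Fin.zero) rest) ⟩
  ℕtoℚ (length (A Fin.zero) ℕ.* length rest)          ≡⟨ ℕtoℚ-homo-* (length (A Fin.zero)) (length rest) ⟩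
  ℕtoℚ (length (A Fin.zero)) ℚ.* ℕtoℚ (length rest)
    ≤⟨ *-mono-≤-nonNeg m≥0 (ℕtoℚ-nonNeg (length rest)) (A≤m Fin.zero)
         (length-vectorsFrom-≤ m≥0 n (A ∘ Fin.suc) (A≤m ∘ Fin.suc)) ⟩
  m ℚ.* m ^ℚ n                                        ∎
  where
  open ℚ.≤-Reasoning
  rest = vectorsFrom n (A ∘ Fin.suc)

length-concatMap-≤ : ∀ {A B : Set} {b} (f : A → List B) → (∀ x → ℕtoℚ (length (f x)) ≤ℚ b) →
  ∀ xs → ℕtoℚ (length (concatMap f xs)) ≤ℚ ℕtoℚ (length xs) ℚ.* b
length-concatMap-≤ {b = b} f fx≤b []       = ℚ.≤-reflexive (sym (ℚ.*-zeroˡ b))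
length-concatMap-≤ {b = b} f fx≤b (x ∷ xs) = begin
  ℕtoℚ (length (f x ++ concatMap f xs))                  ≡⟨ cong ℕtoℚ (length-++ (f x)) ⟩
  ℕtoℚ (length (f x) ℕ.+ length (concatMap f xs))        ≡⟨ ℕtoℚ-homo-+ (length (f x)) _ ⟩
  ℕtoℚ (length (f x)) ℚ.+ ℕtoℚ (length (concatMap f xs)) ≤⟨ ℚ.+-mono-≤ (fx≤b x) (length-concatMap-≤ f fx≤b xs) ⟩
  b ℚ.+ ℕtoℚ (length xs) ℚ.* b                           ≡⟨ solve 2 (λ b n → b :+ n :* b := (con 1ℚ :+ n) :* b) refl b (ℕtoℚ (length xs)) ⟩
  (1ℚ ℚ.+ ℕtoℚ (length xs)) ℚ.* b                        ≡⟨ cong (ℚ._* b) (sym (ℕtoℚ-homo-+ 1 (length xs))) ⟩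
  ℕtoℚ (suc (length xs)) ℚ.* b                           ∎
  where
  open ℚ.≤-Reasoning
  open +-*-Solver

crossing : ∀ {P : ℕ → Set} {n} → Decidable P → ¬ P 0 → P n → Σ ℕ λ d → ¬ P d × P (suc d)
crossing {n = zero}  P? ¬P0 P0 = ⊥-elim (¬P0 P0)
crossing {n = suc n} P? ¬P0 Pn with P? n
... | yes Pn-1 = crossing P? ¬P0 Pn-1
... | no ¬Pn-1 = n , ¬Pn-1 , Pn

_[_↦_] : ∀ {X : Set} → (ℕ → X) → ℕ → X → ℕ → X
(g [ n ↦ y ]) a with a ℕ.≟ n
... | yes _ = y
... | no  _ = g a

[↦]-≡ : ∀ {X : Set} (g : ℕ → X) n y → (g [ n ↦ y ]) n ≡ y
[↦]-≡ g n y with n ℕ.≟ n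
... | yes _   = refl
... | no  n≢n = ⊥-elim (n≢n refl)

[↦]-< : ∀ {X : Set} (g : ℕ → X) {n} y {a} → a < n → (g [ n ↦ y ]) a ≡ g a
[↦]-< g {n} y {a} a<n with a ℕ.≟ n
... | yes a≡n = ⊥-elim (ℕ.<⇒≢ a<n a≡n)
... | no  _   = refl

[↦]-injective : ∀ {X : Set} (g : ℕ → X) {n y} →
  (∀ a b → a < n → b < n → g a ≡ g b → a ≡ b) → (∀ a → a < n → g a ≢ y) →
  ∀ a b → a < suc n → b < suc n → (g [ n ↦ y ]) a ≡ (g [ n ↦ y ]) b → a ≡ b
[↦]-injective g {n} {y} g-inj g≢y a b a<1+n b<1+n eq
  with ℕ.m<1+n⇒m<n∨m≡n a<1+n | ℕ.m<1+n⇒m<n∨m≡n b<1+n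
... | inj₂ refl | inj₂ refl = refl
... | inj₁ a<n  | inj₁ b<n  = g-inj a b a<n b<n (trans (sym ([↦]-< g y a<n)) (trans eq ([↦]-< g y b<n)))
... | inj₁ a<n  | inj₂ refl = ⊥-elim (g≢y a a<n (trans (sym ([↦]-< g y a<n)) (trans eq ([↦]-≡ g n y))))
... | inj₂ refl | inj₁ b<n  = ⊥-elim (g≢y b b<n (trans (sym ([↦]-< g y b<n)) (trans (sym eq) ([↦]-≡ g n y))))

[↦]-preserves : ∀ {X : Set} (Q : X → Set) (g : ℕ → X) {n y} →
  (∀ a → a < n → Q (g a)) → Q y → ∀ a → a < suc n → Q ((g [ n ↦ y ]) a)
[↦]-preserves Q g {n} {y} Qg Qy a a<1+n with ℕ.m<1+n⇒m<n∨m≡n a<1+n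
... | inj₁ a<n  = subst Q (sym ([↦]-< g y a<n)) (Qg a a<n)
... | inj₂ refl = subst Q (sym ([↦]-≡ g n y)) Qy

≢zero⇒≡suc : ∀ {n} {p : Fin (suc n)} → p ≢ Fin.zero → Σ (Fin n) λ q → p ≡ Fin.suc q
≢zero⇒≡suc {p = Fin.zero}  p≢0 = ⊥-elim (p≢0 refl)
≢zero⇒≡suc {p = Fin.suc q} _   = q , refl

∈ᵥ⇒≡lookup : ∀ {X : Set} {n} {xs : Vec X n} {x} → x ∈ᵥ xs → Σ (Fin n) λ p → x ≡ lookup xs p
∈ᵥ⇒≡lookup x∈xs = Anyᵥ.index x∈xs , lookup-index x∈xs

nonempty⇒∈ : ∀ {A : Set} (xs : List A) → 0 < length xs → Σ A (_∈ xs)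
nonempty⇒∈ (x ∷ _) _ = x , here refl

module Peeling {X K : Set} (_≟_ : DecidableEquality K) {n : ℕ} (key : Fin n → X → K) where

  matches? : ∀ i e → Decidable (λ f → key i f ≡ key i e)
  matches? i e f = key i f ≟ key i e

  degree : List X → Fin n → X → ℕ
  degree G i e = length (filter (matches? i e) G)

  record Core (D : ℕ) (G : List X) : Set where
    field
      core        : List X
      core-unique : Unique core
      core⊆G      : ∀ {e} → e ∈ core → e ∈ G
      root        : X
      root∈core   : root ∈ core
      D<degree    : ∀ {e} → e ∈ core → ∀ i → D < degree core i e

  Keyed : List (Fin n × K) → List X → Set
  Keyed A G = ∀ {e} → e ∈ G → ∀ i → (i , key i e) ∈ A

  Core-⊆ : ∀ {D G H} → (∀ {e} → e ∈ G → e ∈ H) → Core D G → Core D H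
  Core-⊆ G⊆H c = record { Core c; core⊆G = G⊆H ∘ Core.core⊆G c }

  empty-or-core : ∀ {D m} G → Unique G → (∀ {e} → e ∈ G → ∀ i → D < degree G i e) → length G ≤ m ⊎ Core D G
  empty-or-core []      _  _        = inj₁ z≤n
  empty-or-core (e ∷ G) G! D<degree = inj₂ record
    { core = e ∷ G ; core-unique = G! ; core⊆G = λ e∈ → e∈ ; root = e ; root∈core = here refl ; D<degree = D<degree }

  peel : ∀ D (A : List (Fin n × K)) G → Unique G → Keyed A G → length G ≤ D ℕ.* length A ⊎ Core D G
  peel D A = go A (<-wellFounded (length A))
    where
    _≟ᴬ_ : DecidableEquality (Fin n × K)
    _≟ᴬ_ = ×-≡-dec Fin._≟_ _≟_

    go : ∀ A → Acc _<_ (length A) → ∀ G → Unique G → Keyed A G → length G ≤ D ℕ.* length A ⊎ Core D G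
    go A (acc smaller) G G! keyed
      with any? (λ e → any? (λ i → degree G i e ℕ.≤? D) (allFin n)) G
    ... | no ¬low = empty-or-core G G! (λ e∈G i → ℕ.≰⇒> (λ deg≤D → ¬low (lose e∈G (lose (∈-allFin i) deg≤D))))
    go A (acc smaller) G G! keyed | yes low
      with e , e∈G , low-at-e ← find low
      with i , _ , deg≤D ← find low-at-e = peel-key
      where
      κ : Fin n × K
      κ = (i , key i e)
      ≢κ? : Decidable (_≢ κ)
      ≢κ? a = ¬? (a ≟ᴬ κ)
      unmatched? : Decidable (λ f → key i f ≢ key i e)
      unmatched? = ∁? (matches? i e)
      A′ : List (Fin n × K)
      A′ = filter ≢κ? A
      G′ : List X
      G′ = filter unmatched? G
      A′<A : length A′ < length A
      A′<A = filter-notAll ≢κ? A (lose (keyed e∈G i) (λ ≢ → ≢ refl))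
      keyed′ : Keyed A′ G′
      keyed′ {f} f∈G′ j with f∈G , fi≢ei ← ∈-filter⁻ unmatched? f∈G′ =
        ∈-filter⁺ ≢κ? (keyed f∈G j) (fi≢ei ∘ same-key)
        where
        same-key : (j , key j f) ≡ κ → key i f ≡ key i e
        same-key eq with refl , fi≡ei ← ,-injective eq = fi≡ei
      peel-key : length G ≤ D ℕ.* length A ⊎ Core D G
      peel-key with go A′ (smaller A′<A) G′ (filter⁺ unmatched? G!) keyed′
      ... | inj₂ c = inj₂ (Core-⊆ (proj₁ ∘ ∈-filter⁻ unmatched?) c)
      ... | inj₁ G′≤ = inj₁ (begin
        length G                                ≡⟨ sym (length-filter-+-∁ (matches? i e) G) ⟩
        degree G i e ℕ.+ length G′              ≤⟨ ℕ.+-mono-≤ deg≤D G′≤ ⟩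
        D ℕ.+ D ℕ.* length A′                   ≡⟨ sym (ℕ.*-suc D (length A′)) ⟩
        D ℕ.* suc (length A′)                   ≤⟨ ℕ.*-monoʳ-≤ D A′<A ⟩
        D ℕ.* length A                          ∎)
        where open ℕ.≤-Reasoning

module Partite {k1 : ℕ} (H : PartiteHypergraph (suc k1)) where
  open PartiteHypergraph H
  open DecMembership (Fin._≟_ {N}) using (_∈?_)

  k : ℕ
  k = suc k1

  Edge : Set
  Edge = Vec (Fin N) (suc k)

  partList : Fin (suc k) → List (Fin N)
  partList p = filter (λ v → part v Fin.≟ p) (allFin N)

  lookup∈partList : ∀ {e} → e ∈ edges → ∀ p → lookup e p ∈ partList p
  lookup∈partList e∈E p = ∈-filter⁺ (λ v → part v Fin.≟ p) (∈-allFin _) (edges-partite _ e∈E p)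

  lookup-part : ∀ {e x} → e ∈ edges → x ∈ᵥ e → lookup e (part x) ≡ x
  lookup-part {e} {x} e∈E x∈e with p , refl ← ∈ᵥ⇒≡lookup x∈e = cong (lookup e) (edges-partite e e∈E p)

  -- the k-1 vertices of e outside V_0 and V_{suc i}
  key : Fin k → Edge → Vec (Fin N) k1
  key i e = removeAt (tail e) i

  lookup-key : ∀ i e p → lookup (key i e) p ≡ lookup e (Fin.suc (Fin.punchIn i p))
  lookup-key i (_ ∷ᵥ e) p = begin
    lookup (removeAt e i) p                                  ≡⟨ cong (lookup (removeAt e i)) (sym (Fin.punchOut-punchIn i)) ⟩
    lookup (removeAt e i) (Fin.punchOut (Fin.punchInᵢ≢i i p ∘ sym)) ≡⟨ removeAt-punchOut e (Fin.punchInᵢ≢i i p ∘ sym) ⟩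
    lookup e (Fin.punchIn i p)                               ∎
    where open ≡-Reasoning

  key-≡⇒lookup-≡ : ∀ {i f e p} → key i f ≡ key i e → i ≢ p → lookup f (Fin.suc p) ≡ lookup e (Fin.suc p)
  key-≡⇒lookup-≡ {i} {_ ∷ᵥ f} {_ ∷ᵥ e} fi≡ei i≢p = begin
    lookup f _                                   ≡⟨ sym (removeAt-punchOut f i≢p) ⟩
    lookup (removeAt f i) (Fin.punchOut i≢p)     ≡⟨ cong (λ w → lookup w (Fin.punchOut i≢p)) fi≡ei ⟩
    lookup (removeAt e i) (Fin.punchOut i≢p)     ≡⟨ removeAt-punchOut e i≢p ⟩
    lookup e _                                   ∎
    where open ≡-Reasoning

  keyPartList : Fin k → Fin k1 → List (Fin N)
  keyPartList i p = partList (Fin.suc (Fin.punchIn i p))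

  keysAt : Fin k → List (Fin k × Vec (Fin N) k1)
  keysAt i = map (i ,_) (vectorsFrom k1 (keyPartList i))

  keys : List (Fin k × Vec (Fin N) k1)
  keys = concatMap keysAt (allFin k)

  key∈keys : ∀ {e} → e ∈ edges → ∀ i → (i , key i e) ∈ keys
  key∈keys {e} e∈E i = ∈-concat⁺′
    (∈-map⁺ (i ,_) (∈-vectorsFrom (keyPartList i) (key i e) λ p →
      subst (_∈ partList _) (sym (lookup-key i e p)) (lookup∈partList e∈E _)))
    (∈-map⁺ keysAt (∈-allFin i))

  length-keys-≤ : ∀ {m} → 0ℚ ≤ℚ m → (∀ p → ℕtoℚ (partSize p) ≤ℚ m) →
    ℕtoℚ (length keys) ≤ℚ ℕtoℚ k ℚ.* m ^ℚ k1
  length-keys-≤ {m} m≥0 |V|≤m = begin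
    ℕtoℚ (length keys)                        ≤⟨ length-concatMap-≤ keysAt keysAt-≤ (allFin k) ⟩
    ℕtoℚ (length (allFin k)) ℚ.* m ^ℚ k1      ≡⟨ cong (λ n → ℕtoℚ n ℚ.* m ^ℚ k1) (length-tabulate {n = k} id) ⟩
    ℕtoℚ k ℚ.* m ^ℚ k1                        ∎
    where
    open ℚ.≤-Reasoning
    keysAt-≤ : ∀ i → ℕtoℚ (length (keysAt i)) ≤ℚ m ^ℚ k1
    keysAt-≤ i = subst (λ n → ℕtoℚ n ≤ℚ m ^ℚ k1) (sym (length-map (i ,_) (vectorsFrom k1 (keyPartList i))))
      (length-vectorsFrom-≤ m≥0 k1 (keyPartList i) (λ p → |V|≤m (Fin.suc (Fin.punchIn i p))))

  lookup-injective : ∀ {e} → e ∈ edges → ∀ {p q} → lookup e p ≡ lookup e q → p ≡ q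
  lookup-injective {e} e∈E {p} {q} eq =
    trans (sym (edges-partite e e∈E p)) (trans (cong part eq) (edges-partite e e∈E q))

  key-determines : ∀ {i f g} → key i f ≡ key i g →
    lookup f Fin.zero ≡ lookup g Fin.zero → lookup f (Fin.suc i) ≡ lookup g (Fin.suc i) → f ≡ g
  key-determines {i} {f} {g} fi≡gi f0≡g0 fi+1≡gi+1 = Pointwise-≡⇒≡ (ext agree)
    where
    agree : ∀ p → lookup f p ≡ lookup g p
    agree Fin.zero    = f0≡g0
    agree (Fin.suc q) with i Fin.≟ q
    ... | yes refl = fi+1≡gi+1
    ... | no  i≢q  = key-≡⇒lookup-≡ {f = f} {g} fi≡gi i≢q

  module Peel = Peeling (Vecₚ.≡-dec Fin._≟_) key

  PathEdge : (ℕ → Fin N) → (ℕ → Fin N) → ℕ → Fin N → Set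
  PathEdge c v j x = x ≡ c j ⊎ Σ ℕ λ l → l < k × x ≡ v (j ℕ.+ l)

  PathEdge-cong : ∀ {c v c′ v′ j} → c′ j ≡ c j → (∀ l → l < k → v′ (j ℕ.+ l) ≡ v (j ℕ.+ l)) →
    ∀ x → PathEdge c v j x ⇔ PathEdge c′ v′ j x
  PathEdge-cong c′≡c v′≡v x = mk⇔
    (Sum.map (λ x≡ → trans x≡ (sym c′≡c)) (λ (l , l<k , x≡) → l , l<k , trans x≡ (sym (v′≡v l l<k))))
    (Sum.map (λ x≡ → trans x≡ c′≡c) (λ (l , l<k , x≡) → l , l<k , trans x≡ (v′≡v l l<k)))

  module Greedy {D : ℕ} (C : Peel.Core D edges) where
    open Peel.Core C

    record CorePath (t : ℕ) : Set where
      field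
        path          : Path0 (suc t)
        last          : Edge
        last∈core     : last ∈ core
        last-vertices : ∀ x → x ∈ᵥ last ⇔ PathEdge (Path0.c path) (Path0.v path) t x

    start : CorePath 0
    start = record
      { path = record
        { c      = λ _ → lookup root Fin.zero
        ; v      = v₀
        ; c-inj  = λ { zero zero _ _ _ → refl ; (suc _) _ (s≤s ()) _ _ ; _ (suc _) _ (s≤s ()) _ }
        ; v-inj  = λ a b a<k b<k eq → trans (sym (toℕ-mod a<k))
                     (trans (cong Fin.toℕ (Fin.suc-injective (lookup-injective root∈E eq))) (toℕ-mod b<k))
        ; c-part = λ _ _ → edges-partite root root∈E Fin.zero
        ; v-part = λ a _ eq → case trans (sym (edges-partite root root∈E _)) eq of λ ()
        ; edge   = λ { zero _ → root , root∈E , root-vertices ; (suc _) (s≤s ()) } }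
      ; last = root ; last∈core = root∈core ; last-vertices = root-vertices }
      where
      root∈E : root ∈ edges
      root∈E = core⊆G root∈core
      -- only the values below k matter; `mod` just makes v₀ total
      v₀ : ℕ → Fin N
      v₀ a = lookup root (Fin.suc (a mod k))
      toℕ-mod : ∀ {a} → a < k → Fin.toℕ (a mod k) ≡ a
      toℕ-mod a<k = trans (Fin.toℕ-fromℕ< _) (m<n⇒m%n≡m a<k)
      root-vertices : ∀ x → x ∈ᵥ root ⇔ PathEdge (λ _ → lookup root Fin.zero) v₀ 0 x
      root-vertices x = mk⇔ to (λ { (inj₁ refl) → ∈-lookup Fin.zero root ; (inj₂ (_ , _ , refl)) → ∈-lookup _ root })
        where
        to : x ∈ᵥ root → PathEdge (λ _ → lookup root Fin.zero) v₀ 0 x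
        to x∈ with ∈ᵥ⇒≡lookup x∈
        ... | Fin.zero  , refl = inj₁ refl
        ... | Fin.suc q , refl = inj₂ (Fin.toℕ q , Fin.toℕ<n q ,
              cong (lookup root ∘ Fin.suc) (sym (Fin.toℕ-injective (toℕ-mod (Fin.toℕ<n q)))))

    -- what blocks the extension of a path of length suc t: too few candidates avoid its vertices
    Stuck : ℕ → Set
    Stuck t = Σ (Fin (suc k)) λ p → suc D ≤ suc t ℕ.* partSize p ℕ.+ partSize Fin.zero ℕ.* (t ℕ.+ k)

    module Step {t} (P : CorePath t) where
      open CorePath P

      c v : ℕ → Fin N
      c = Path0.c path
      v = Path0.v path

      last∈E : last ∈ edges
      last∈E = core⊆G last∈core

      t<t+k : t < t ℕ.+ k
      t<t+k = ℕ.m<m+n t (s≤s z≤n)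

      vt∈last : v t ∈ᵥ last
      vt∈last = Equivalence.from (last-vertices (v t)) (inj₂ (0 , s≤s z≤n , cong v (sym (ℕ.+-identityʳ t))))

      -- the next edge must replace v t, which lies in the part V_{suc i}
      i : Fin k
      i = proj₁ (≢zero⇒≡suc (Path0.v-part path t t<t+k))

      part-vt : part (v t) ≡ Fin.suc i
      part-vt = proj₂ (≢zero⇒≡suc (Path0.v-part path t t<t+k))

      last[i]≡vt : lookup last (Fin.suc i) ≡ v t
      last[i]≡vt = trans (cong (lookup last) (sym part-vt)) (lookup-part last∈E vt∈last)

      matches? : Decidable (λ f → key i f ≡ key i last)
      matches? = Peel.matches? i last

      candidates : List Edge
      candidates = filter matches? core

      usedC usedV : List (Fin N)
      usedC = map c (upTo (suc t))
      usedV = map v (upTo (t ℕ.+ k))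

      Fresh : Edge → Set
      Fresh f = lookup f Fin.zero ∉ usedC × lookup f (Fin.suc i) ∉ usedV

      fresh? : (f : Edge) → Dec (Fresh f)
      fresh? f = ¬? (lookup f Fin.zero ∈? usedC) ×-dec ¬? (lookup f (Fin.suc i) ∈? usedV)

      staleEnds : List (Fin N × Fin N)
      staleEnds = cartesianProduct usedC (partList (Fin.suc i)) ++ cartesianProduct (partList Fin.zero) usedV

      length-staleEnds : length staleEnds ≡ suc t ℕ.* partSize (Fin.suc i) ℕ.+ partSize Fin.zero ℕ.* (t ℕ.+ k)
      length-staleEnds = begin
        length staleEnds
          ≡⟨ length-++ (cartesianProduct usedC (partList (Fin.suc i))) ⟩
        length (cartesianProduct usedC (partList (Fin.suc i))) ℕ.+ length (cartesianProduct (partList Fin.zero) usedV)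
          ≡⟨ cong₂ ℕ._+_ (length-cartesianProductWith _,_ usedC (partList (Fin.suc i)))
                         (length-cartesianProductWith _,_ (partList Fin.zero) usedV) ⟩
        length usedC ℕ.* partSize (Fin.suc i) ℕ.+ partSize Fin.zero ℕ.* length usedV
          ≡⟨ cong₂ (λ a b → a ℕ.* partSize (Fin.suc i) ℕ.+ partSize Fin.zero ℕ.* b)
               (trans (length-map c (upTo (suc t))) (length-upTo (suc t)))
               (trans (length-map v (upTo (t ℕ.+ k))) (length-upTo (t ℕ.+ k))) ⟩
        suc t ℕ.* partSize (Fin.suc i) ℕ.+ partSize Fin.zero ℕ.* (t ℕ.+ k) ∎
        where open ≡-Reasoning

      ends : Edge → Fin N × Fin N
      ends f = lookup f Fin.zero , lookup f (Fin.suc i)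

      ends-injective : ∀ {f g} → f ∈ candidates → g ∈ candidates → ends f ≡ ends g → f ≡ g
      ends-injective {f} {g} f∈ g∈ eq
        with _ , fi≡ ← ∈-filter⁻ matches? {xs = core} f∈ | _ , gi≡ ← ∈-filter⁻ matches? {xs = core} g∈ =
        key-determines {f = f} {g} (trans fi≡ (sym gi≡)) (cong proj₁ eq) (cong proj₂ eq)

      stale-ends : ∀ {f} → f ∈ candidates → ¬ Fresh f → ends f ∈ staleEnds
      stale-ends {f} f∈ stale with f∈core , _ ← ∈-filter⁻ matches? {xs = core} f∈
                                 | lookup f Fin.zero ∈? usedC | lookup f (Fin.suc i) ∈? usedV
      ... | yes used | _ = ∈-++⁺ˡ (∈-cartesianProduct⁺ used (lookup∈partList (core⊆G f∈core) _))
      ... | no  _    | yes used =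
        ∈-++⁺ʳ (cartesianProduct usedC (partList (Fin.suc i))) (∈-cartesianProduct⁺ (lookup∈partList (core⊆G f∈core) _) used)
      ... | no  c-new | no v-new = ⊥-elim (stale (c-new , v-new))

      stuck : ¬ Any Fresh candidates → Stuck t
      stuck none-fresh = Fin.suc i , (begin
        suc D               ≤⟨ D<degree last∈core i ⟩
        length candidates   ≤⟨ length-≤-injection (×-≡-dec Fin._≟_ Fin._≟_) ends
                                 (filter⁺ matches? core-unique) ends-injective
                                 (λ f∈ → stale-ends f∈ (none-fresh ∘ lose f∈)) ⟩
        length staleEnds    ≡⟨ length-staleEnds ⟩
        _                   ∎)
        where open ℕ.≤-Reasoning

      module Extend {f} (f∈ : f ∈ candidates) (fresh : Fresh f) where
        f∈core : f ∈ core
        f∈core = proj₁ (∈-filter⁻ matches? {xs = core} f∈)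

        f∈E : f ∈ edges
        f∈E = core⊆G f∈core

        f-matches : key i f ≡ key i last
        f-matches = proj₂ (∈-filter⁻ matches? {xs = core} f∈)

        c′ v′ : ℕ → Fin N
        c′ = c [ suc t ↦ lookup f Fin.zero ]
        v′ = v [ t ℕ.+ k ↦ lookup f (Fin.suc i) ]

        v′-old : ∀ {a} → a < t ℕ.+ k → v′ a ≡ v a
        v′-old = [↦]-< v (lookup f (Fin.suc i))

        v′-new : v′ (suc t ℕ.+ k1) ≡ lookup f (Fin.suc i)
        v′-new = trans (cong v′ (sym (ℕ.+-suc t k1))) ([↦]-≡ v (t ℕ.+ k) _)

        shifted : ∀ {l} → l < k1 → suc t ℕ.+ l < t ℕ.+ k
        shifted {l} l<k1 = subst (_< t ℕ.+ k) (ℕ.+-suc t l) (ℕ.+-monoʳ-< t (s≤s l<k1))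

        v′-shifted : ∀ {l} → l < k1 → v′ (suc t ℕ.+ l) ≡ v (t ℕ.+ suc l)
        v′-shifted {l} l<k1 = trans (v′-old (shifted l<k1)) (cong v (sym (ℕ.+-suc t l)))

        new-vertices→ : ∀ x → x ∈ᵥ f → PathEdge c′ v′ (suc t) x
        new-vertices→ x x∈f with ∈ᵥ⇒≡lookup x∈f
        ... | Fin.zero  , refl = inj₁ (sym ([↦]-≡ c (suc t) _))
        ... | Fin.suc q , refl with i Fin.≟ q
        ...   | yes refl = inj₂ (k1 , ℕ.n<1+n k1 , sym v′-new)
        ...   | no  i≢q with Equivalence.to (last-vertices _) (∈-lookup (Fin.suc q) last)
        ...     | inj₁ y≡ct = case trans (sym (edges-partite last last∈E (Fin.suc q)))
                                (trans (cong part y≡ct) (Path0.c-part path t (ℕ.n<1+n t))) of λ ()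
        ...     | inj₂ (zero , _ , y≡vt) = ⊥-elim (i≢q (Fin.suc-injective (lookup-injective last∈E
                    (trans last[i]≡vt (sym (trans y≡vt (cong v (ℕ.+-identityʳ t))))))))
        ...     | inj₂ (suc l , s≤s l<k1 , y≡v) = inj₂ (l , ℕ.m<n⇒m<1+n l<k1 ,
                    trans (key-≡⇒lookup-≡ {f = f} {last} f-matches i≢q) (trans y≡v (sym (v′-shifted l<k1))))

        new-vertices← : ∀ x → PathEdge c′ v′ (suc t) x → x ∈ᵥ f
        new-vertices← x (inj₁ x≡) = subst (_∈ᵥ f) (sym (trans x≡ ([↦]-≡ c (suc t) _))) (∈-lookup Fin.zero f)
        new-vertices← x (inj₂ (l , l<k , x≡)) with ℕ.m<1+n⇒m<n∨m≡n l<k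
        ... | inj₂ refl = subst (_∈ᵥ f) (sym (trans x≡ v′-new)) (∈-lookup (Fin.suc i) f)
        ... | inj₁ l<k1 = subst (_∈ᵥ f) f[part-x]≡x (∈-lookup (part x) f)
          where
          x≡v : x ≡ v (t ℕ.+ suc l)
          x≡v = trans x≡ (v′-shifted l<k1)
          t+l+1<t+k : t ℕ.+ suc l < t ℕ.+ k
          t+l+1<t+k = ℕ.+-monoʳ-< t (s≤s l<k1)
          last[part-x]≡x : lookup last (part x) ≡ x
          last[part-x]≡x = lookup-part last∈E (Equivalence.from (last-vertices x) (inj₂ (suc l , s≤s l<k1 , x≡v)))
          part-x≢0 : part x ≢ Fin.zero
          part-x≢0 = Path0.v-part path (t ℕ.+ suc l) t+l+1<t+k ∘ trans (cong part (sym x≡v))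
          q : Fin k
          q = proj₁ (≢zero⇒≡suc part-x≢0)
          part-x : part x ≡ Fin.suc q
          part-x = proj₂ (≢zero⇒≡suc part-x≢0)
          -- x is not v t, which is the vertex of last in V_{suc i}
          i≢q : i ≢ q
          i≢q i≡q = ℕ.<⇒≢ t<t+l+1 (Path0.v-inj path t (t ℕ.+ suc l) t<t+k t+l+1<t+k (begin
            v t                         ≡⟨ sym last[i]≡vt ⟩
            lookup last (Fin.suc i)     ≡⟨ cong (lookup last ∘ Fin.suc) i≡q ⟩
            lookup last (Fin.suc q)     ≡⟨ cong (lookup last) (sym part-x) ⟩
            lookup last (part x)        ≡⟨ last[part-x]≡x ⟩
            x                           ≡⟨ x≡v ⟩
            v (t ℕ.+ suc l)             ∎))
            where
            open ≡-Reasoning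
            t<t+l+1 : t < t ℕ.+ suc l
            t<t+l+1 = ℕ.m<m+n t (s≤s z≤n)
          f[part-x]≡x : lookup f (part x) ≡ x
          f[part-x]≡x = begin
            lookup f (part x)           ≡⟨ cong (lookup f) part-x ⟩
            lookup f (Fin.suc q)        ≡⟨ key-≡⇒lookup-≡ {f = f} {last} f-matches i≢q ⟩
            lookup last (Fin.suc q)     ≡⟨ cong (lookup last) (sym part-x) ⟩
            lookup last (part x)        ≡⟨ last[part-x]≡x ⟩
            x                           ∎
            where open ≡-Reasoning

        extended : CorePath (suc t)
        extended = record
          { path = record
            { c      = c′
            ; v      = v′
            ; c-inj  = [↦]-injective c (Path0.c-inj path)
                         (λ a a<1+t ca≡ → proj₁ fresh (subst (_∈ usedC) ca≡ (∈-map⁺ c (∈-upTo⁺ a<1+t))))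
            ; v-inj  = [↦]-injective v (Path0.v-inj path)
                         (λ a a<t+k va≡ → proj₂ fresh (subst (_∈ usedV) va≡ (∈-map⁺ v (∈-upTo⁺ a<t+k))))
            ; c-part = [↦]-preserves (λ y → part y ≡ Fin.zero) c (Path0.c-part path) (edges-partite f f∈E Fin.zero)
            ; v-part = [↦]-preserves (λ y → part y ≢ Fin.zero) v (Path0.v-part path)
                         (λ eq → case trans (sym (edges-partite f f∈E (Fin.suc i))) eq of λ ())
            ; edge   = edge′ }
          ; last = f ; last∈core = f∈core ; last-vertices = λ x → mk⇔ (new-vertices→ x) (new-vertices← x) }
          where
          edge′ : ∀ j → j < suc (suc t) → IsEdge (PathEdge c′ v′ j)
          edge′ j j<2+t with ℕ.m<1+n⇒m<n∨m≡n j<2+t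
          ... | inj₂ refl = f , f∈E , λ x → mk⇔ (new-vertices→ x) (new-vertices← x)
          ... | inj₁ j<1+t with Path0.edge path j j<1+t
          ...   | e , e∈E , e-vertices = e , e∈E , λ x → PathEdge-cong {c} {v} {c′} {v′} {j} ([↦]-< c _ j<1+t)
                    (λ l l<k → v′-old (ℕ.+-mono-≤-< (ℕ.≤-pred j<1+t) l<k)) x ⇔-∘ e-vertices x

    step : ∀ {t} → CorePath t → CorePath (suc t) ⊎ Stuck t
    step P with any? (Step.fresh? P) (Step.candidates P)
    ... | yes some = let _ , f∈ , fresh = find some in inj₁ (Step.Extend.extended P f∈ fresh)
    ... | no  none = inj₂ (Step.stuck P none)

    path-length-≤ : ∀ {t} → CorePath t → suc t ≤ N
    path-length-≤ {t} P = subst₂ _≤_ (length-upTo (suc t)) (length-tabulate {n = N} id)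
      (length-≤-injection Fin._≟_ (Path0.c path) (upTo⁺ (suc t))
        (λ a∈ b∈ → Path0.c-inj path _ _ (∈-upTo⁻ a∈) (∈-upTo⁻ b∈)) (λ _ → ∈-allFin _))
      where open CorePath P

    grow : ∀ fuel {t} → N < suc t ℕ.+ fuel → CorePath t → Σ ℕ λ t → CorePath t × Stuck t
    grow zero       {t} N<1+t P = ⊥-elim (ℕ.<⇒≱ N<1+t (subst (_≤ N) (sym (ℕ.+-identityʳ (suc t))) (path-length-≤ P)))
    grow (suc fuel) {t} N<    P with step P
    ... | inj₂ stuck = t , P , stuck
    ... | inj₁ P′    = grow fuel (subst (N <_) (ℕ.+-suc (suc t) fuel) N<) P′

    stuck-path : Σ ℕ λ t → CorePath t × Stuck t
    stuck-path = grow N (ℕ.n<1+n N) start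

  numEdges-pos : ∀ {c m} → 0ℚ <ℚ c → 0ℚ <ℚ m → c ℚ.* m ^ℚ suc k ≤ℚ ℕtoℚ numEdges → 0 < numEdges
  numEdges-pos {c} {m} c>0 m>0 many = ℕtoℚ-pos⇒pos (ℚ.<-≤-trans
    (ℚ.positive⁻¹ _ {{ℚ.pos*pos⇒pos c {{positive c>0}} (m ^ℚ suc k) {{positive (^ℚ-pos m>0 (suc k))}}}}) many)

  keys-nonempty : 0 < numEdges → 0 < length keys
  keys-nonempty 0<E = ∈-length (key∈keys (proj₂ (nonempty⇒∈ edges 0<E)) Fin.zero)

  long-path : ∀ {c m} → 0ℚ <ℚ c → 0ℚ <ℚ m → (∀ p → ℕtoℚ (partSize p) ≤ℚ m) →
    c ℚ.* m ^ℚ suc k ≤ℚ ℕtoℚ numEdges →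
    Σ ℕ λ t → 1 ≤ t × Path0 t × c ℚ.* m ≤ℚ ℕtoℚ k ℚ.* ℕtoℚ (pathVertexCount t)
  long-path {c} {m} c>0 m>0 |V|≤m many = from-peeling (Peel.peel D keys edges edges-unique key∈keys)
    where
    E |A| : ℕ
    E = numEdges
    |A| = length keys
    threshold : Σ ℕ λ d → ¬ E ≤ d ℕ.* |A| × E ≤ suc d ℕ.* |A|
    threshold = crossing {P = λ d → E ≤ d ℕ.* |A|} {n = E} (λ d → E ℕ.≤? d ℕ.* |A|)
      (ℕ.<⇒≱ (numEdges-pos c>0 m>0 many))
      (ℕ.m≤m*n E |A| {{ℕ.>-nonZero (keys-nonempty (numEdges-pos c>0 m>0 many))}})
    D : ℕ
    D = proj₁ threshold

    from-peeling : E ≤ D ℕ.* |A| ⊎ Peel.Core D edges →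
      Σ ℕ λ t → 1 ≤ t × Path0 t × c ℚ.* m ≤ℚ ℕtoℚ k ℚ.* ℕtoℚ (pathVertexCount t)
    from-peeling (inj₁ E≤D|A|) = ⊥-elim (proj₁ (proj₂ threshold) E≤D|A|)
    from-peeling (inj₂ C) = from-stuck (Greedy.stuck-path C)
      where
      from-stuck : Σ ℕ (λ t → Greedy.CorePath C t × Greedy.Stuck C t) →
        Σ ℕ λ t → 1 ≤ t × Path0 t × c ℚ.* m ≤ℚ ℕtoℚ k ℚ.* ℕtoℚ (pathVertexCount t)
      from-stuck (t , P , p , stuck) = suc t , s≤s z≤n , Greedy.CorePath.path P ,
        counting-estimate {c} {m} k1 {a = suc t} {t ℕ.+ k} {partSize p} {partSize Fin.zero} m>0
          many (proj₂ (proj₂ threshold)) (length-keys-≤ (ℚ.<⇒≤ m>0) |V|≤m) stuck (|V|≤m p) (|V|≤m Fin.zero)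

lemma4p5 : (c m : ℚ) (k : ℕ) → 0ℚ <ℚ c → 0ℚ <ℚ m → 2 ≤ k →
    (H : PartiteHypergraph k) →
    (∀ i → ℕtoℚ (PartiteHypergraph.partSize H i) ≤ℚ m) →
    c * (m ^ℚ suc k) ≤ℚ ℕtoℚ (PartiteHypergraph.numEdges H) →
    Σ ℕ λ t → 1 ≤ t × PartiteHypergraph.Path0 H t
    × c * m ≤ℚ ℕtoℚ k * ℕtoℚ (PartiteHypergraph.pathVertexCount H t)
-- the argument only needs k ≥ 1
lemma4p5 c m (suc _) c>0 m>0 _ H |V|≤m many = Partite.long-path H c>0 m>0 |V|≤m many
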